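{- Let $q\ge9$ with $q\equiv0\pmod3$, and let $\psi\in G_q$ fix the point $\mathrm{P}(1,0,1,0)$. Then $\psi$ is induced by a matrix $\mathrm{diag}(1,d,d^2,d^3)$ with $d\in\{1,-1\}$. Moreover, every point $P$ of $\mathrm{PG}(3,q)$ satisfies $P\psi=P$ if $d=1$ and $P\psi^2=P$ if $d=-1$, and for every $\mu,\gamma\in\mathbb{F}_q$ we have $\mathrm{P}(\gamma,\mu,\gamma,1)\psi=\mathrm{P}(d\gamma,\mu,d\gamma,1)$.
   Context: $\mathrm{P}(x_0,x_1,x_2,x_3)$ denotes a point of $\mathrm{PG}(3,q)$ in homogeneous coordinates; a matrix $M$ induces the projectivity $\mathrm{P}(x)\mapsto\mathrm{P}(xM)$ ($x$ a row vector). The twisted cubic is $\mathcal{C}=\{P(t): t\in\mathbb{F}_q\cup\{\infty\}\}$, $P(t)=\mathrm{P}(t^3,t^2,t,1)$ for $t\in\mathbb{F}_q$, $P(\infty)=\mathrm{P}(1,0,0,0)$. $G_q$ is the group of projectivities mapping $\mathcal{C}$ onto itself; for $q\ge5$ its elements are exactly those induced by $M=\begin{pmatrix} a^3&a^2c&ac^2&c^3\\ 3a^2b&a^2d+2abc&bc^2+2acd&3c^2d\\ 3ab^2&b^2c+2abd&ad^2+2bcd&3cd^2\\ b^3&b^2d&bd^2&d^3\end{pmatrix}$, $a,b,c,d\in\mathbb{F}_q$, $ad-bc\ne0$ (up to nonzero scalar). -}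

module Defs where

open import Level using (0ℓ) renaming (suc to lsuc)
open import Algebra.Bundles using (CommutativeRing)
open import Data.Nat using (ℕ)
open import Data.Fin using (Fin; zero; suc)
open import Data.Product using (∃; _×_)
open import Relation.Nullary using (¬_)
import Relation.Binary.PropositionalEquality as ≡
open import Function.Bundles using (Bijection)

record IsFieldOn (R : CommutativeRing 0ℓ 0ℓ) : Set where
  open CommutativeRing R
  field
    0≉1     : ¬ (0# ≈ 1#)
    inverse : ∀ x → ¬ (x ≈ 0#) → ∃ λ y → x * y ≈ 1#

record FiniteField (q : ℕ) : Set₁ where
  field
    cring   : CommutativeRing 0ℓ 0ℓ
    isField : IsFieldOn cring
    enum    : Bijection (≡.setoid (Fin q)) (CommutativeRing.setoid cring)
  open CommutativeRing cring public hiding (ring)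

module PG3 {q : ℕ} (F : FiniteField q) where
  open FiniteField F using (Carrier; _≈_; _+_; _*_; 0#; 1#)

  -- row vectors of length 4 (homogeneous coordinates x0,x1,x2,x3)
  Vec4 : Set
  Vec4 = Fin 4 → Carrier

  Mat4 : Set
  Mat4 = Fin 4 → Fin 4 → Carrier

  vec : Carrier → Carrier → Carrier → Carrier → Vec4
  vec x0 x1 x2 x3 zero = x0
  vec x0 x1 x2 x3 (suc zero) = x1
  vec x0 x1 x2 x3 (suc (suc zero)) = x2
  vec x0 x1 x2 x3 (suc (suc (suc zero))) = x3

  mat : Vec4 → Vec4 → Vec4 → Vec4 → Mat4
  mat r0 r1 r2 r3 i j = vec (r0 j) (r1 j) (r2 j) (r3 j) i

  -- a vector represents a point of PG(3,q) iff it is nonzero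
  NonZeroVec : Vec4 → Set
  NonZeroVec x = ¬ (∀ i → x i ≈ 0#)

  -- P(x) = P(y): y is a nonzero scalar multiple of x
  _∼_ : Vec4 → Vec4 → Set
  x ∼ y = ∃ λ t → ¬ (t ≈ 0#) × (∀ i → y i ≈ t * x i)

  _·_ : Vec4 → Mat4 → Vec4
  (x · M) j = x zero * M zero j
            + x (suc zero) * M (suc zero) j
            + x (suc (suc zero)) * M (suc (suc zero)) j
            + x (suc (suc (suc zero))) * M (suc (suc (suc zero))) j

  three : Carrier
  three = 1# + 1# + 1#

  _² : Carrier → Carrier
  x ² = x * x

  _³ : Carrier → Carrier
  x ³ = x * x * x

  -- the matrix M(a,b,c,d) inducing the elements of G_q (q ≥ 5)
  Mabcd : Carrier → Carrier → Carrier → Carrier → Mat4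
  Mabcd a b c d = mat
    (vec (a ³) (a ² * c) (a * c ²) (c ³))
    (vec (three * a ² * b) (a ² * d + (1# + 1#) * a * b * c)
         (b * c ² + (1# + 1#) * a * c * d) (three * c ² * d))
    (vec (three * a * b ²) (b ² * c + (1# + 1#) * a * b * d)
         (a * d ² + (1# + 1#) * b * c * d) (three * c * d ²))
    (vec (b ³) (b ² * d) (b * d ²) (d ³))

  diag4 : Carrier → Mat4
  diag4 δ = mat (vec 1# 0# 0# 0#) (vec 0# δ 0# 0#)
                (vec 0# 0# (δ ²) 0#) (vec 0# 0# 0# (δ ³))

  SameProjectivity : Mat4 → Mat4 → Set
  SameProjectivity M N = ∀ x → NonZeroVec x → (x · M) ∼ (x · N)

{-# OPTIONS --safe #-}
-- If 3 ∣ q then F has characteristic three: otherwise (x , y) ↦ (y , - x - y) would be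
-- a permutation of F² of order three whose only fixed point is the origin, so that
-- q² ≡ 1 (mod 3).  In characteristic three the image of P(1,0,1,0) under M(a,b,c,d) is
-- P(a³, c(a² + b²) - abd, c(ac - bd) + ad², c³).  If this is P(1,0,1,0), then c = 0,
-- hence a, d ≠ 0 (as ad - bc ≠ 0), b = 0 and a³ = ad², i.e. d = δa with δ = ±1.  Then
-- M(a,0,0,δa) = a³ diag(1, δ, δ², δ³), which up to the scalar a³ multiplies the
-- coordinates by (1, δ, 1, δ); every remaining claim is read off from this.
module Submission where

open import Defs
open import Data.Nat using (_≤_)
open import Data.Nat.Divisibility using (_∣_)
open import Data.Product using (∃; _×_)
open import Data.Sum using (_⊎_)
open import Relation.Nullary using (¬_)

open import Algebra.Bundles using (CommutativeRing; RawRing)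
open import Algebra.Solver.Ring.AlmostCommutativeRing
  using (AlmostCommutativeRing; fromCommutativeRing; _-Raw-AlmostCommutative⟶_)
open import Data.Fin using (Fin; #_)
open import Data.Fin.Patterns using (0F; 1F; 2F; 3F)
open import Data.Fin.Properties using (*↔×) renaming (_≟_ to _≟ᶠ_)
open import Data.Maybe using (Maybe; just; nothing)
open import Data.Nat using (ℕ; zero; suc) renaming (_*_ to _*ℕ_)
open import Data.Nat.Divisibility using (∣m⇒∣m*n)
open import Data.Product using (_,_)
open import Data.Product.Function.NonDependent.Setoid using (_×-inverse_)
open import Data.Product.Relation.Binary.Pointwise.NonDependent using (_×ₛ_; Pointwise-≡↔≡)
open import Data.Sum using (inj₁; inj₂)
open import Data.Vec using (Vec; []; _∷_)
open import Data.Vec.N-ary using (N-ary)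
open import Data.Vec.Relation.Binary.Pointwise.Inductive as Pointwise using (Pointwise; []; _∷_)
open import Function using (_∘_; Congruent; Inverse)
import Function.Construct.Composition as Compose
import Function.Construct.Symmetry as Symmetry
open import Function.Properties.Bijection using (Bijection⇒Inverse)
open import Relation.Binary using (Setoid; Decidable)
import Relation.Binary.PropositionalEquality as ≡
open ≡ using (_≡_)
open import Relation.Nullary using (yes; no; contradiction)
open import Relation.Nullary.Decidable using (map′)

module OrbitsOfOrderThree where
  open import Data.Nat using (ℕ; zero; suc; _+_; _*_)
  open import Data.Nat.Divisibility using (∣m+n∣m⇒∣n; m∣m*n; ∣1⇒≡1)
  open import Data.Nat.Properties using (+-0-commutativeMonoid; +-identityʳ; +-comm; +-assoc)
  open import Algebra.Properties.CommutativeMonoid.Sum +-0-commutativeMonoid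
    using (sum; sum-remove; sum-permute; ∑-distrib-+; sum-cong-≗)
  open import Data.Fin using (toℕ; punchIn)
  open import Data.Fin.Permutation using (Permutation′; permutation)
  open import Data.Fin.Properties using (toℕ-injective; punchInᵢ≢i)
  open import Data.Vec.Functional using (removeAt)
  open ≡

  isStrictMin : ℕ → ℕ → ℕ → ℕ
  isStrictMin zero    (suc _) (suc _) = 1
  isStrictMin (suc x) (suc y) (suc z) = isStrictMin x y z
  isStrictMin _       _       _       = 0

  isStrictMin-refl : ∀ x z → isStrictMin x x z ≡ 0
  isStrictMin-refl zero    z       = refl
  isStrictMin-refl (suc x) zero    = refl
  isStrictMin-refl (suc x) (suc z) = isStrictMin-refl x z

  isStrictMin-rotations : ∀ {x y z} → x ≢ y → y ≢ z → x ≢ z →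
    isStrictMin x y z + isStrictMin y z x + isStrictMin z x y ≡ 1
  isStrictMin-rotations {zero}  {zero}  x≢y _ _ = contradiction refl x≢y
  isStrictMin-rotations {zero}  {suc y} {zero}  _ _ x≢z = contradiction refl x≢z
  isStrictMin-rotations {zero}  {suc y} {suc z} _ _ _ = refl
  isStrictMin-rotations {suc x} {zero}  {zero}  _ y≢z _ = contradiction refl y≢z
  isStrictMin-rotations {suc x} {zero}  {suc z} _ _ _ = refl
  isStrictMin-rotations {suc x} {suc y} {zero}  _ _ _ = refl
  isStrictMin-rotations {suc x} {suc y} {suc z} x≢y y≢z x≢z =
    isStrictMin-rotations (x≢y ∘ cong suc) (y≢z ∘ cong suc) (x≢z ∘ cong suc)

  sum-const-1 : ∀ n → sum {n} (λ _ → 1) ≡ n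
  sum-const-1 zero    = refl
  sum-const-1 (suc n) = cong suc (sum-const-1 n)

  module _ {n} (f : Fin (suc n) → Fin (suc n))
    (f³≡id : ∀ i → f (f (f i)) ≡ i) (e : Fin (suc n)) (fe≡e : f e ≡ e)
    (fixed⇒≡e : ∀ i → f i ≡ i → i ≡ e) where

    -- Counts every orbit {i, f i, f (f i)} of size three once, at its least element.
    isOrbitMin : Fin (suc n) → ℕ
    isOrbitMin i = isStrictMin (toℕ i) (toℕ (f i)) (toℕ (f (f i)))

    orbitCount : Fin (suc n) → ℕ
    orbitCount i = isOrbitMin i + isOrbitMin (f i) + isOrbitMin (f (f i))

    isOrbitMin-fixed : ∀ i → f i ≡ i → isOrbitMin i ≡ 0
    isOrbitMin-fixed i fi≡i rewrite fi≡i = isStrictMin-refl (toℕ i) (toℕ (f i))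

    orbitCount-fixed : orbitCount e ≡ 0
    orbitCount-fixed = cong₂ _+_
      (cong₂ _+_ (isOrbitMin-fixed e fe≡e) (isOrbitMin-fixed (f e) (cong f fe≡e)))
      (isOrbitMin-fixed (f (f e)) (cong (f ∘ f) fe≡e))

    orbitCount-moved : ∀ i → i ≢ e → orbitCount i ≡ 1
    orbitCount-moved i i≢e
      rewrite f³≡id i = isStrictMin-rotations i≢fi fi≢ffi i≢ffi
      where
      i≢fi : toℕ i ≢ toℕ (f i)
      i≢fi eq = i≢e (fixed⇒≡e i (sym (toℕ-injective eq)))
      fi≢ffi : toℕ (f i) ≢ toℕ (f (f i))
      fi≢ffi eq = i≢fi (cong toℕ (begin
        i                 ≡⟨ f³≡id i ⟨
        f (f (f i))       ≡⟨ cong (f ∘ f) (toℕ-injective eq) ⟩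
        f (f (f (f i)))   ≡⟨ cong f (f³≡id i) ⟩
        f i               ∎))
        where open ≡-Reasoning
      i≢ffi : toℕ i ≢ toℕ (f (f i))
      i≢ffi eq = i≢fi (cong toℕ (sym (trans (cong f (toℕ-injective eq)) (f³≡id i))))

    sum-orbitCount : sum orbitCount ≡ 3 * sum isOrbitMin
    sum-orbitCount = begin
      sum orbitCount
        ≡⟨ ∑-distrib-+ (λ i → isOrbitMin i + isOrbitMin (f i)) (isOrbitMin ∘ f ∘ f) ⟩
      sum (λ i → isOrbitMin i + isOrbitMin (f i)) + sum (isOrbitMin ∘ f ∘ f)
        ≡⟨ cong (_+ sum (isOrbitMin ∘ f ∘ f)) (∑-distrib-+ isOrbitMin (isOrbitMin ∘ f)) ⟩
      S + sum (isOrbitMin ∘ f) + sum (isOrbitMin ∘ f ∘ f)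
        ≡⟨ cong₂ (λ u v → S + u + v) S≡S∘f (trans S≡S∘f (sum-permute (isOrbitMin ∘ f) π)) ⟨
      S + S + S
        ≡⟨ +-assoc S S S ⟩
      S + (S + S)
        ≡⟨ cong (λ t → S + (S + t)) (+-identityʳ S) ⟨
      3 * S ∎
      where
      open ≡-Reasoning
      S : ℕ
      S = sum isOrbitMin
      π : Permutation′ (suc n)
      π = permutation f (f ∘ f) f³≡id f³≡id
      S≡S∘f : S ≡ sum (isOrbitMin ∘ f)
      S≡S∘f = sum-permute isOrbitMin π

    size≡3k+1 : suc n ≡ 3 * sum isOrbitMin + 1
    size≡3k+1 = begin
      suc n                               ≡⟨ cong suc (sum-const-1 n) ⟨
      suc (sum {n} (λ _ → 1))             ≡⟨ cong suc (sum-cong-≗ moved) ⟨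
      suc (sum rest)                      ≡⟨ cong (λ t → suc (t + sum rest)) orbitCount-fixed ⟨
      suc (orbitCount e + sum rest)       ≡⟨ cong suc (sum-remove {i = e} orbitCount) ⟨
      suc (sum orbitCount)                ≡⟨ cong suc sum-orbitCount ⟩
      suc (3 * sum isOrbitMin)            ≡⟨ +-comm 1 _ ⟩
      3 * sum isOrbitMin + 1              ∎
      where
      open ≡-Reasoning
      rest : Fin n → ℕ
      rest = removeAt orbitCount e
      moved : ∀ j → rest j ≡ 1
      moved j = orbitCount-moved (punchIn e j) (punchInᵢ≢i e j)

    ¬3∣size : ¬ 3 ∣ suc n
    ¬3∣size 3∣size = contradiction (∣1⇒≡1 3∣1) λ ()
      where
      3∣1 : 3 ∣ 1
      3∣1 = ∣m+n∣m⇒∣n (subst (3 ∣_) size≡3k+1 3∣size) (m∣m*n (sum isOrbitMin))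

module _ {c ℓ} {S : Setoid c ℓ} where
  open Setoid S

  finite⇒decidable : ∀ {n} → Inverse (≡.setoid (Fin n)) S → Decidable _≈_
  finite⇒decidable enum x y = map′ from-injective from-cong (from x ≟ᶠ from y)
    where
    open Inverse enum
    from-injective : from x ≡ from y → x ≈ y
    from-injective eq =
      trans (sym (strictlyInverseˡ x)) (trans (reflexive (≡.cong to eq)) (strictlyInverseˡ y))

  order3-unique-fixed-point⇒¬3∣ : ∀ {n} → Inverse (≡.setoid (Fin n)) S →
    (f : Carrier → Carrier) → Congruent _≈_ _≈_ f → (∀ x → f (f (f x)) ≈ x) →
    ∀ e → f e ≈ e → (∀ x → f x ≈ x → x ≈ e) → ¬ 3 ∣ n
  order3-unique-fixed-point⇒¬3∣ {zero} enum f _ _ e _ _ with Inverse.from enum e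
  ... | ()
  order3-unique-fixed-point⇒¬3∣ {suc n} enum f f-cong f³≈id e fe≈e fixed⇒≈e =
    OrbitsOfOrderThree.¬3∣size g g³≡id (from e) ge≡e g-fixed⇒≡e
    where
    open Inverse enum
    g : Fin (suc n) → Fin (suc n)
    g = from ∘ f ∘ to
    to∘g : ∀ i → to (g i) ≈ f (to i)
    to∘g i = strictlyInverseˡ (f (to i))
    g³≡id : ∀ i → g (g (g i)) ≡ i
    g³≡id i = ≡.trans (from-cong (f-cong (trans (to∘g (g i)) (f-cong (to∘g i)))))
                      (≡.trans (from-cong (f³≈id (to i))) (strictlyInverseʳ i))
    ge≡e : g (from e) ≡ from e
    ge≡e = from-cong (trans (f-cong (strictlyInverseˡ e)) fe≈e)
    g-fixed⇒≡e : ∀ i → g i ≡ i → i ≡ from e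
    g-fixed⇒≡e i gi≡i = ≡.trans (≡.sym (strictlyInverseʳ i))
      (from-cong (fixed⇒≈e (to i) (trans (sym (to∘g i)) (reflexive (≡.cong to gi≡i)))))

module FieldProperties {q} (F : FiniteField q) where
  open FiniteField F hiding (zero)
  open PG3 F
  open IsFieldOn isField
  open import Relation.Binary.Reasoning.Setoid setoid
  open import Algebra.Properties.Group +-group
    using (⁻¹-anti-homo-∙; ⁻¹-involutive; \\-leftDividesʳ; //-rightDividesʳ)
  open import Algebra.Properties.Ring (CommutativeRing.ring cring) using (-0#≈0#; -1*x≈-x)

  enumeration : Inverse (≡.setoid (Fin q)) setoid
  enumeration = Bijection⇒Inverse enum

  _≟_ : Decidable _≈_
  _≟_ = finite⇒decidable enumeration

  *-cancelˡ : ∀ {t x y} → ¬ t ≈ 0# → t * x ≈ t * y → x ≈ y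
  *-cancelˡ {t} {x} {y} t≉0 tx≈ty with inverse t t≉0
  ... | u , tu≈1 = begin
    x            ≈⟨ *-identityˡ x ⟨
    1# * x       ≈⟨ *-congʳ (trans (sym tu≈1) (*-comm t u)) ⟩
    u * t * x    ≈⟨ *-assoc u t x ⟩
    u * (t * x)  ≈⟨ *-congˡ tx≈ty ⟩
    u * (t * y)  ≈⟨ *-assoc u t y ⟨
    u * t * y    ≈⟨ *-congʳ (trans (sym tu≈1) (*-comm t u)) ⟨
    1# * y       ≈⟨ *-identityˡ y ⟩
    y            ∎

  x*y≈0⇒y≈0 : ∀ {x y} → ¬ x ≈ 0# → x * y ≈ 0# → y ≈ 0#
  x*y≈0⇒y≈0 {x} x≉0 xy≈0 = *-cancelˡ x≉0 (trans xy≈0 (sym (zeroʳ x)))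

  x*y≈0⇒x≈0 : ∀ {x y} → ¬ y ≈ 0# → x * y ≈ 0# → x ≈ 0#
  x*y≈0⇒x≈0 {x} {y} y≉0 xy≈0 = x*y≈0⇒y≈0 y≉0 (trans (*-comm y x) xy≈0)

  x*y≈0⇒x≈0⊎y≈0 : ∀ {x y} → x * y ≈ 0# → x ≈ 0# ⊎ y ≈ 0#
  x*y≈0⇒x≈0⊎y≈0 {x} xy≈0 with x ≟ 0#
  ... | yes x≈0 = inj₁ x≈0
  ... | no  x≉0 = inj₂ (x*y≈0⇒y≈0 x≉0 xy≈0)

  *-preserves-≉0 : ∀ {x y} → ¬ x ≈ 0# → ¬ y ≈ 0# → ¬ x * y ≈ 0#
  *-preserves-≉0 x≉0 y≉0 xy≈0 = y≉0 (x*y≈0⇒y≈0 x≉0 xy≈0)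

  x³≈0⇒x≈0 : ∀ {x} → x ³ ≈ 0# → x ≈ 0#
  x³≈0⇒x≈0 {x} x³≈0 with x ≟ 0#
  ... | yes x≈0 = x≈0
  ... | no  x≉0 = contradiction x³≈0 (*-preserves-≉0 (*-preserves-≉0 x≉0 x≉0) x≉0)

  -x≈0⇒x≈0 : ∀ {x} → - x ≈ 0# → x ≈ 0#
  -x≈0⇒x≈0 {x} -x≈0 = trans (sym (⁻¹-involutive x)) (trans (-‿cong -x≈0) -0#≈0#)

  x≈0⇒x*y+z≈z : ∀ {x} y z → x ≈ 0# → x * y + z ≈ z
  x≈0⇒x*y+z≈z {x} y z x≈0 = trans (+-congʳ (trans (*-congʳ x≈0) (zeroˡ y))) (+-identityˡ z)

  ∼-scale : ∀ {x y : Vec4} s → ¬ s ≈ 0# → (∀ i → x i ≈ s * y i) → x ∼ y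
  ∼-scale {x} {y} s s≉0 x≈sy with inverse s s≉0
  ... | u , su≈1 = u , u≉0 , λ i → *-cancelˡ s≉0 (begin
    s * y i        ≈⟨ x≈sy i ⟨
    x i            ≈⟨ *-identityˡ (x i) ⟨
    1# * x i       ≈⟨ *-congʳ su≈1 ⟨
    s * u * x i    ≈⟨ *-assoc s u (x i) ⟩
    s * (u * x i)  ∎)
    where
    u≉0 : ¬ u ≈ 0#
    u≉0 u≈0 = 0≉1 (trans (sym (zeroʳ s)) (trans (*-congˡ (sym u≈0)) su≈1))

  vec-η : ∀ (y : Vec4) j → vec (y 0F) (y 1F) (y 2F) (y 3F) j ≡ y j
  vec-η y 0F = ≡.refl
  vec-η y 1F = ≡.refl
  vec-η y 2F = ≡.refl
  vec-η y 3F = ≡.refl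

  δ≈±1⇒δ²≈1 : ∀ {δ} → δ ≈ 1# ⊎ δ ≈ - 1# → δ * δ ≈ 1#
  δ≈±1⇒δ²≈1 (inj₁ δ≈1)  = trans (*-cong δ≈1 δ≈1) (*-identityˡ 1#)
  δ≈±1⇒δ²≈1 (inj₂ δ≈-1) = trans (*-cong δ≈-1 δ≈-1) (trans (-1*x≈-x (- 1#)) (⁻¹-involutive 1#))

  open Setoid (setoid ×ₛ setoid) using () renaming (_≈_ to _≈²_)

  pairEnumeration : Inverse (≡.setoid (Fin (q *ℕ q))) (setoid ×ₛ setoid)
  pairEnumeration = Compose.inverse *↔×
    (Compose.inverse (Symmetry.inverse Pointwise-≡↔≡) (enumeration ×-inverse enumeration))

  rotate : Carrier × Carrier → Carrier × Carrier
  rotate (x , y) = y , - x - y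

  rotate-cong : ∀ {p p′} → p ≈² p′ → rotate p ≈² rotate p′
  rotate-cong (x≈x′ , y≈y′) = y≈y′ , +-cong (-‿cong x≈x′) (-‿cong y≈y′)

  -‿[-x-y] : ∀ x y → - (- x - y) ≈ y + x
  -‿[-x-y] x y = trans (⁻¹-anti-homo-∙ (- x) (- y)) (+-cong (⁻¹-involutive y) (⁻¹-involutive x))

  rotate³ : ∀ p → rotate (rotate (rotate p)) ≈² p
  rotate³ (x , y) = first , (begin
    - (- x - y) - (- y - (- x - y))  ≈⟨ +-congˡ (-‿cong first) ⟩
    - (- x - y) - x                  ≈⟨ +-congʳ (-‿[-x-y] x y) ⟩
    y + x - x                        ≈⟨ //-rightDividesʳ x y ⟩
    y                                ∎)
    where
    first : - y - (- x - y) ≈ x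
    first = trans (+-congˡ (-‿[-x-y] x y)) (\\-leftDividesʳ y x)

  rotate-origin : rotate (0# , 0#) ≈² (0# , 0#)
  rotate-origin = refl , trans (+-cong -0#≈0# -0#≈0#) (+-identityʳ 0#)

  three*x≈x+x+x : ∀ x → three * x ≈ x + x + x
  three*x≈x+x+x x = trans (distribʳ x (1# + 1#) 1#)
    (+-cong (trans (distribʳ x 1# 1#) (+-cong (*-identityˡ x) (*-identityˡ x))) (*-identityˡ x))

  -x-x≈x⇒three*x≈0 : ∀ {x} → - x - x ≈ x → three * x ≈ 0#
  -x-x≈x⇒three*x≈0 {x} -x-x≈x = begin
    three * x           ≈⟨ three*x≈x+x+x x ⟩
    x + x + x           ≈⟨ +-congˡ -x-x≈x ⟨
    x + x + (- x - x)   ≈⟨ +-congˡ (⁻¹-anti-homo-∙ x x) ⟨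
    x + x - (x + x)     ≈⟨ -‿inverseʳ (x + x) ⟩
    0#                  ∎

  three≉0⇒¬3∣q : ¬ three ≈ 0# → ¬ 3 ∣ q
  three≉0⇒¬3∣q three≉0 3∣q = order3-unique-fixed-point⇒¬3∣ pairEnumeration rotate
    rotate-cong rotate³ (0# , 0#) rotate-origin rotate-fixed⇒origin (∣m⇒∣m*n q 3∣q)
    where
    rotate-fixed⇒origin : ∀ p → rotate p ≈² p → p ≈² (0# , 0#)
    rotate-fixed⇒origin (x , y) (y≈x , -x-y≈y) = x≈0 , trans y≈x x≈0
      where
      x≈0 : x ≈ 0#
      x≈0 = x*y≈0⇒y≈0 three≉0 (-x-x≈x⇒three*x≈0
              (trans (+-congˡ (-‿cong (sym y≈x))) (trans -x-y≈y y≈x)))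

  characteristic-three : 3 ∣ q → three ≈ 0#
  characteristic-three 3∣q with three ≟ 0#
  ... | yes three≈0 = three≈0
  ... | no  three≉0 = contradiction 3∣q (three≉0⇒¬3∣q three≉0)

data 𝔽₃ : Set where
  0₃ 1₃ -1₃ : 𝔽₃

_+₃_ : 𝔽₃ → 𝔽₃ → 𝔽₃
0₃  +₃ y   = y
x   +₃ 0₃  = x
1₃  +₃ 1₃  = -1₃
1₃  +₃ -1₃ = 0₃
-1₃ +₃ 1₃  = 0₃
-1₃ +₃ -1₃ = 1₃

_*₃_ : 𝔽₃ → 𝔽₃ → 𝔽₃
0₃  *₃ y   = 0₃
1₃  *₃ y   = y
-1₃ *₃ 0₃  = 0₃
-1₃ *₃ 1₃  = -1₃
-1₃ *₃ -1₃ = 1₃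

-₃_ : 𝔽₃ → 𝔽₃
-₃ 0₃  = 0₃
-₃ 1₃  = -1₃
-₃ -1₃ = 1₃

𝔽₃-rawRing : RawRing _ _
𝔽₃-rawRing = record
  { Carrier = 𝔽₃ ; _≈_ = _≡_ ; _+_ = _+₃_ ; _*_ = _*₃_ ; -_ = -₃_ ; 0# = 0₃ ; 1# = 1₃ }

module CharacteristicThree {q} (F : FiniteField q)
  (three≈0 : FiniteField._≈_ F (PG3.three F) (FiniteField.0# F)) where

  open FiniteField F hiding (zero)
  open PG3 F
  open FieldProperties F
  open import Relation.Binary.Reasoning.Setoid setoid
  open import Algebra.Properties.Group +-group
    using (⁻¹-anti-homo-∙; ⁻¹-involutive; //-rightDividesʳ; x∙y⁻¹≈ε⇒x≈y; inverseʳ-unique)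
  open import Algebra.Properties.Ring (CommutativeRing.ring cring) using (-0#≈0#; -1*x≈-x)

  1+1≈-1 : 1# + 1# ≈ - 1#
  1+1≈-1 = begin
    1# + 1#            ≈⟨ //-rightDividesʳ 1# (1# + 1#) ⟨
    1# + 1# + 1# - 1#  ≈⟨ +-congʳ three≈0 ⟩
    0# - 1#            ≈⟨ +-identityˡ (- 1#) ⟩
    - 1#               ∎

  ⟦_⟧₃ : 𝔽₃ → Carrier
  ⟦ 0₃  ⟧₃ = 0#
  ⟦ 1₃  ⟧₃ = 1#
  ⟦ -1₃ ⟧₃ = - 1#

  ⟦⟧₃-+ : ∀ x y → ⟦ x +₃ y ⟧₃ ≈ ⟦ x ⟧₃ + ⟦ y ⟧₃
  ⟦⟧₃-+ 0₃  y   = sym (+-identityˡ _)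
  ⟦⟧₃-+ 1₃  0₃  = sym (+-identityʳ _)
  ⟦⟧₃-+ -1₃ 0₃  = sym (+-identityʳ _)
  ⟦⟧₃-+ 1₃  1₃  = sym 1+1≈-1
  ⟦⟧₃-+ 1₃  -1₃ = sym (-‿inverseʳ 1#)
  ⟦⟧₃-+ -1₃ 1₃  = sym (-‿inverseˡ 1#)
  ⟦⟧₃-+ -1₃ -1₃ = begin
    1#             ≈⟨ ⁻¹-involutive 1# ⟨
    - - 1#         ≈⟨ -‿cong 1+1≈-1 ⟨
    - (1# + 1#)    ≈⟨ ⁻¹-anti-homo-∙ 1# 1# ⟩
    - 1# + - 1#    ∎

  ⟦⟧₃-* : ∀ x y → ⟦ x *₃ y ⟧₃ ≈ ⟦ x ⟧₃ * ⟦ y ⟧₃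
  ⟦⟧₃-* 0₃  y   = sym (zeroˡ _)
  ⟦⟧₃-* 1₃  y   = sym (*-identityˡ _)
  ⟦⟧₃-* -1₃ 0₃  = sym (zeroʳ _)
  ⟦⟧₃-* -1₃ 1₃  = sym (*-identityʳ _)
  ⟦⟧₃-* -1₃ -1₃ = sym (trans (-1*x≈-x (- 1#)) (⁻¹-involutive 1#))

  ⟦⟧₃-neg : ∀ x → ⟦ -₃ x ⟧₃ ≈ - ⟦ x ⟧₃
  ⟦⟧₃-neg 0₃  = sym -0#≈0#
  ⟦⟧₃-neg 1₃  = refl
  ⟦⟧₃-neg -1₃ = sym (⁻¹-involutive 1#)

  -- With coefficients in 𝔽₃ the ring solver knows that 3 = 0, which the computations
  -- with the entries of Mabcd below depend on.
  primeFieldEmbedding : 𝔽₃-rawRing -Raw-AlmostCommutative⟶ fromCommutativeRing cring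
  primeFieldEmbedding = record
    { ⟦_⟧ = ⟦_⟧₃ ; +-homo = ⟦⟧₃-+ ; *-homo = ⟦⟧₃-* ; -‿homo = ⟦⟧₃-neg
    ; 0-homo = refl ; 1-homo = refl
    }

  ⟦⟧₃-equal? : ∀ x y → Maybe (⟦ x ⟧₃ ≈ ⟦ y ⟧₃)
  ⟦⟧₃-equal? 0₃  0₃  = just refl
  ⟦⟧₃-equal? 1₃  1₃  = just refl
  ⟦⟧₃-equal? -1₃ -1₃ = just refl
  ⟦⟧₃-equal? _   _   = nothing

  open import Algebra.Solver.Ring
    𝔽₃-rawRing (fromCommutativeRing cring) primeFieldEmbedding ⟦⟧₃-equal?
    using (solve; _:=_; _:+_; _:*_; :-_; _:-_; con; var; Polynomial; ⟦_⟧; op; _:^_; Op)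

  open import Algebra.Properties.Semiring.Exp
    (AlmostCommutativeRing.semiring (fromCommutativeRing cring)) using (^-congˡ)

  ⟦⟧-cong : ∀ {n} (p : Polynomial n) {ρ ρ′ : Vec Carrier n} →
    Pointwise _≈_ ρ ρ′ → ⟦ p ⟧ ρ ≈ ⟦ p ⟧ ρ′
  ⟦⟧-cong (op Op.[+] p₁ p₂) ρ≈ρ′ = +-cong (⟦⟧-cong p₁ ρ≈ρ′) (⟦⟧-cong p₂ ρ≈ρ′)
  ⟦⟧-cong (op Op.[*] p₁ p₂) ρ≈ρ′ = *-cong (⟦⟧-cong p₁ ρ≈ρ′) (⟦⟧-cong p₂ ρ≈ρ′)
  ⟦⟧-cong (con c)          ρ≈ρ′ = refl
  ⟦⟧-cong (var x)          ρ≈ρ′ = Pointwise.lookup ρ≈ρ′ x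
  ⟦⟧-cong (p :^ k)         ρ≈ρ′ = ^-congˡ k (⟦⟧-cong p ρ≈ρ′)
  ⟦⟧-cong (:- p)           ρ≈ρ′ = -‿cong (⟦⟧-cong p ρ≈ρ′)

  -- Syntactic copies of vec, mat, _·_, Mabcd and diag4: their ⟦_⟧-semantics are
  -- definitionally the originals, which is what lets the solver reason about them.
  module _ {n : ℕ} where
    vecᴾ : (p₀ p₁ p₂ p₃ : Polynomial n) → Fin 4 → Polynomial n
    vecᴾ p₀ p₁ p₂ p₃ 0F = p₀
    vecᴾ p₀ p₁ p₂ p₃ 1F = p₁
    vecᴾ p₀ p₁ p₂ p₃ 2F = p₂
    vecᴾ p₀ p₁ p₂ p₃ 3F = p₃

    matᴾ : (r₀ r₁ r₂ r₃ : Fin 4 → Polynomial n) → Fin 4 → Fin 4 → Polynomial n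
    matᴾ r₀ r₁ r₂ r₃ i j = vecᴾ (r₀ j) (r₁ j) (r₂ j) (r₃ j) i

    _·ᴾ_ : (Fin 4 → Polynomial n) → (Fin 4 → Fin 4 → Polynomial n) → Fin 4 → Polynomial n
    (x ·ᴾ M) j = x 0F :* M 0F j :+ x 1F :* M 1F j
               :+ x 2F :* M 2F j
               :+ x 3F :* M 3F j

    zeroᴾ oneᴾ twoᴾ threeᴾ : Polynomial n
    zeroᴾ  = con 0₃
    oneᴾ   = con 1₃
    twoᴾ   = oneᴾ :+ oneᴾ
    threeᴾ = twoᴾ :+ oneᴾ

    _²ᴾ _³ᴾ : Polynomial n → Polynomial n
    p ²ᴾ = p :* p
    p ³ᴾ = p :* p :* p

    Mabcdᴾ : (a b c d : Polynomial n) → Fin 4 → Fin 4 → Polynomial n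
    Mabcdᴾ a b c d = matᴾ
      (vecᴾ (a ³ᴾ) (a ²ᴾ :* c) (a :* c ²ᴾ) (c ³ᴾ))
      (vecᴾ (threeᴾ :* a ²ᴾ :* b) (a ²ᴾ :* d :+ twoᴾ :* a :* b :* c)
            (b :* c ²ᴾ :+ twoᴾ :* a :* c :* d) (threeᴾ :* c ²ᴾ :* d))
      (vecᴾ (threeᴾ :* a :* b ²ᴾ) (b ²ᴾ :* c :+ twoᴾ :* a :* b :* d)
            (a :* d ²ᴾ :+ twoᴾ :* b :* c :* d) (threeᴾ :* c :* d ²ᴾ))
      (vecᴾ (b ³ᴾ) (b ²ᴾ :* d) (b :* d ²ᴾ) (d ³ᴾ))

    diag4ᴾ : Polynomial n → Fin 4 → Fin 4 → Polynomial n
    diag4ᴾ δ = matᴾ (vecᴾ oneᴾ zeroᴾ zeroᴾ zeroᴾ) (vecᴾ zeroᴾ δ zeroᴾ zeroᴾ)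
                    (vecᴾ zeroᴾ zeroᴾ (δ ²ᴾ) zeroᴾ) (vecᴾ zeroᴾ zeroᴾ zeroᴾ (δ ³ᴾ))

  P₁₀₁₀ : Vec4
  P₁₀₁₀ = vec 1# 0# 1# 0#

  private
    P₁₀₁₀ᴾ : ∀ {n} → Fin 4 → Polynomial n
    P₁₀₁₀ᴾ = vecᴾ oneᴾ zeroᴾ oneᴾ zeroᴾ

  P₁₀₁₀·M₀ : ∀ a b c d → (P₁₀₁₀ · Mabcd a b c d) 0F ≈ a ³
  P₁₀₁₀·M₀ = solve 4 (λ a b c d → (P₁₀₁₀ᴾ ·ᴾ Mabcdᴾ a b c d) 0F := a ³ᴾ) refl

  P₁₀₁₀·M₁ : ∀ a b c d → (P₁₀₁₀ · Mabcd a b c d) 1F ≈ c * (a ² + b ²) - a * b * d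
  P₁₀₁₀·M₁ = solve 4 (λ a b c d → (P₁₀₁₀ᴾ ·ᴾ Mabcdᴾ a b c d) 1F
                                  := c :* (a ²ᴾ :+ b ²ᴾ) :- a :* b :* d) refl

  P₁₀₁₀·M₂ : ∀ a b c d → (P₁₀₁₀ · Mabcd a b c d) 2F ≈ c * (a * c - b * d) + a * d ²
  P₁₀₁₀·M₂ = solve 4 (λ a b c d → (P₁₀₁₀ᴾ ·ᴾ Mabcdᴾ a b c d) 2F
                                  := c :* (a :* c :- b :* d) :+ a :* d ²ᴾ) refl

  P₁₀₁₀·M₃ : ∀ a b c d → (P₁₀₁₀ · Mabcd a b c d) 3F ≈ c ³
  P₁₀₁₀·M₃ = solve 4 (λ a b c d → (P₁₀₁₀ᴾ ·ᴾ Mabcdᴾ a b c d) 3F := c ³ᴾ) refl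

  ·Mabcd-cong : ∀ {a b c d a′ b′ c′ d′} → a ≈ a′ → b ≈ b′ → c ≈ c′ → d ≈ d′ →
    ∀ (y : Vec4) j → (y · Mabcd a b c d) j ≈ (y · Mabcd a′ b′ c′ d′) j
  ·Mabcd-cong {a} {b} {c} {d} {a′} {b′} {c′} {d′} a≈a′ b≈b′ c≈c′ d≈d′ y = column-cong
    where
    ρ ρ′ : Vec Carrier 8
    ρ  = y 0F ∷ y 1F ∷ y 2F ∷ y 3F ∷ a ∷ b ∷ c ∷ d ∷ []
    ρ′ = y 0F ∷ y 1F ∷ y 2F ∷ y 3F ∷ a′ ∷ b′ ∷ c′ ∷ d′ ∷ []
    ρ≈ρ′ : Pointwise _≈_ ρ ρ′
    ρ≈ρ′ = refl ∷ refl ∷ refl ∷ refl ∷ a≈a′ ∷ b≈b′ ∷ c≈c′ ∷ d≈d′ ∷ []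
    columnᴾ : Fin 4 → Polynomial 8
    columnᴾ = vecᴾ (var (# 0)) (var (# 1)) (var (# 2)) (var (# 3))
           ·ᴾ Mabcdᴾ (var (# 4)) (var (# 5)) (var (# 6)) (var (# 7))
    column-cong : ∀ j → (y · Mabcd a b c d) j ≈ (y · Mabcd a′ b′ c′ d′) j
    column-cong 0F = ⟦⟧-cong (columnᴾ 0F) ρ≈ρ′
    column-cong 1F = ⟦⟧-cong (columnᴾ 1F) ρ≈ρ′
    column-cong 2F = ⟦⟧-cong (columnᴾ 2F) ρ≈ρ′
    column-cong 3F = ⟦⟧-cong (columnᴾ 3F) ρ≈ρ′

  ·Mabcd-diagonal : ∀ a δ (y : Vec4) j → (y · Mabcd a 0# 0# (δ * a)) j ≈ a ³ * (y · diag4 δ) j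
  ·Mabcd-diagonal a δ y j = column j (y 0F) (y 1F) (y 2F) (y 3F) a δ
    where
    column : ∀ j y₀ y₁ y₂ y₃ a δ →
      (vec y₀ y₁ y₂ y₃ · Mabcd a 0# 0# (δ * a)) j ≈ a ³ * (vec y₀ y₁ y₂ y₃ · diag4 δ) j
    identity : Fin 4 → N-ary 6 (Polynomial 6) (Polynomial 6 × Polynomial 6)
    identity j y₀ y₁ y₂ y₃ a δ = (vecᴾ y₀ y₁ y₂ y₃ ·ᴾ Mabcdᴾ a zeroᴾ zeroᴾ (δ :* a)) j
                              := a ³ᴾ :* (vecᴾ y₀ y₁ y₂ y₃ ·ᴾ diag4ᴾ δ) j
    column 0F = solve 6 (identity 0F) refl
    column 1F = solve 6 (identity 1F) refl
    column 2F = solve 6 (identity 2F) refl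
    column 3F = solve 6 (identity 3F) refl

  ·diag4 : ∀ δ (y : Vec4) j → (y · diag4 δ) j ≈ vec 1# δ (δ ²) (δ ³) j * y j
  ·diag4 δ y j = trans (column j (y 0F) (y 1F) (y 2F) (y 3F) δ)
                       (*-congˡ (reflexive (vec-η y j)))
    where
    column : ∀ j y₀ y₁ y₂ y₃ δ →
      (vec y₀ y₁ y₂ y₃ · diag4 δ) j ≈ vec 1# δ (δ ²) (δ ³) j * vec y₀ y₁ y₂ y₃ j
    identity : Fin 4 → N-ary 5 (Polynomial 5) (Polynomial 5 × Polynomial 5)
    identity j y₀ y₁ y₂ y₃ δ = (vecᴾ y₀ y₁ y₂ y₃ ·ᴾ diag4ᴾ δ) j
                            := vecᴾ oneᴾ δ (δ ²ᴾ) (δ ³ᴾ) j :* vecᴾ y₀ y₁ y₂ y₃ j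
    column 0F = solve 5 (identity 0F) refl
    column 1F = solve 5 (identity 1F) refl
    column 2F = solve 5 (identity 2F) refl
    column 3F = solve 5 (identity 3F) refl

  record DiagonalForm (a b c d : Carrier) : Set where
    field
      δ    : Carrier
      δ≈±1 : δ ≈ 1# ⊎ δ ≈ - 1#
      a≉0  : ¬ a ≈ 0#
      b≈0  : b ≈ 0#
      c≈0  : c ≈ 0#
      d≈δa : d ≈ δ * a

  det≈c*[-b]+a*d : ∀ a b c d → a * d - b * c ≈ c * (- b) + a * d
  det≈c*[-b]+a*d = solve 4 (λ a b c d → a :* d :- b :* c := c :* (:- b) :+ a :* d) refl

  a³-ad²≈a[a-d][a+d] : ∀ a d → a ³ - a * d ² ≈ a * ((a - d) * (a + d))
  a³-ad²≈a[a-d][a+d] = solve 2 (λ a d → a ³ᴾ :- a :* d ²ᴾ := a :* ((a :- d) :* (a :+ d))) refl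

  fixes-P₁₀₁₀⇒equations : ∀ {a b c d} → (P₁₀₁₀ · Mabcd a b c d) ∼ P₁₀₁₀ →
    c ³ ≈ 0# × c * (a ² + b ²) - a * b * d ≈ 0# × a ³ ≈ c * (a * c - b * d) + a * d ²
  fixes-P₁₀₁₀⇒equations {a} {b} {c} {d} (t , t≉0 , P≈tX) =
    trans (sym (P₁₀₁₀·M₃ a b c d)) (x*y≈0⇒y≈0 t≉0 (sym (P≈tX 3F))) ,
    trans (sym (P₁₀₁₀·M₁ a b c d)) (x*y≈0⇒y≈0 t≉0 (sym (P≈tX 1F))) ,
    trans (sym (P₁₀₁₀·M₀ a b c d))
      (trans (*-cancelˡ t≉0 (trans (sym (P≈tX 0F)) (P≈tX 2F))) (P₁₀₁₀·M₂ a b c d))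

  equations⇒diagonalForm : ∀ {a b c d} → ¬ (a * d - b * c ≈ 0#) → c ³ ≈ 0# →
    c * (a ² + b ²) - a * b * d ≈ 0# → a ³ ≈ c * (a * c - b * d) + a * d ² →
    DiagonalForm a b c d
  equations⇒diagonalForm {a} {b} {c} {d} det≉0 c³≈0 X₁≈0 a³≈X₂ =
    let δ , δ≈±1 , d≈δa = root (x*y≈0⇒x≈0⊎y≈0 [a-d][a+d]≈0)
    in record { δ = δ ; δ≈±1 = δ≈±1 ; a≉0 = a≉0 ; b≈0 = b≈0 ; c≈0 = c≈0 ; d≈δa = d≈δa }
    where
    c≈0 : c ≈ 0#
    c≈0 = x³≈0⇒x≈0 c³≈0
    ad≉0 : ¬ a * d ≈ 0#
    ad≉0 ad≈0 = det≉0 (begin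
      a * d - b * c        ≈⟨ det≈c*[-b]+a*d a b c d ⟩
      c * (- b) + a * d    ≈⟨ x≈0⇒x*y+z≈z (- b) (a * d) c≈0 ⟩
      a * d                ≈⟨ ad≈0 ⟩
      0#                   ∎)
    a≉0 : ¬ a ≈ 0#
    a≉0 a≈0 = ad≉0 (trans (*-congʳ a≈0) (zeroˡ d))
    d≉0 : ¬ d ≈ 0#
    d≉0 d≈0 = ad≉0 (trans (*-congˡ d≈0) (zeroʳ a))
    b≈0 : b ≈ 0#
    b≈0 = x*y≈0⇒y≈0 a≉0 (x*y≈0⇒x≈0 d≉0
      (-x≈0⇒x≈0 (trans (sym (x≈0⇒x*y+z≈z (a ² + b ²) (- (a * b * d)) c≈0)) X₁≈0)))
    [a-d][a+d]≈0 : (a - d) * (a + d) ≈ 0#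
    [a-d][a+d]≈0 = x*y≈0⇒y≈0 a≉0 (begin
      a * ((a - d) * (a + d))   ≈⟨ a³-ad²≈a[a-d][a+d] a d ⟨
      a ³ - a * d ²             ≈⟨ +-congʳ (trans a³≈X₂ (x≈0⇒x*y+z≈z (a * c - b * d) (a * d ²) c≈0)) ⟩
      a * d ² - a * d ²         ≈⟨ -‿inverseʳ (a * d ²) ⟩
      0#                        ∎)
    root : (a - d ≈ 0# ⊎ a + d ≈ 0#) → ∃ λ δ → (δ ≈ 1# ⊎ δ ≈ - 1#) × d ≈ δ * a
    root (inj₁ a-d≈0) = 1# , inj₁ refl , trans (sym (x∙y⁻¹≈ε⇒x≈y a d a-d≈0)) (sym (*-identityˡ a))
    root (inj₂ a+d≈0) = - 1# , inj₂ refl , trans (inverseʳ-unique a d a+d≈0) (sym (-1*x≈-x a))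

  fixes-P₁₀₁₀⇒diagonalForm : ∀ {a b c d} → ¬ (a * d - b * c ≈ 0#) →
    (P₁₀₁₀ · Mabcd a b c d) ∼ P₁₀₁₀ → DiagonalForm a b c d
  fixes-P₁₀₁₀⇒diagonalForm det≉0 fixes =
    let c³≈0 , X₁≈0 , a³≈X₂ = fixes-P₁₀₁₀⇒equations fixes
    in equations⇒diagonalForm det≉0 c³≈0 X₁≈0 a³≈X₂

  module DiagonalFormProperties {a b c d} (form : DiagonalForm a b c d) where
    open DiagonalForm form

    M : Mat4
    M = Mabcd a b c d

    signs : Vec4
    signs = vec 1# δ 1# δ

    δ²≈1 : δ * δ ≈ 1#
    δ²≈1 = δ≈±1⇒δ²≈1 δ≈±1

    signs²≈1 : ∀ j → signs j * signs j ≈ 1#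
    signs²≈1 0F = *-identityˡ 1#
    signs²≈1 1F = δ²≈1
    signs²≈1 2F = *-identityˡ 1#
    signs²≈1 3F = δ²≈1

    ·diag4≈signs* : ∀ (y : Vec4) j → (y · diag4 δ) j ≈ signs j * y j
    ·diag4≈signs* y j = trans (·diag4 δ y j) (*-congʳ (powers j))
      where
      powers : ∀ j → vec 1# δ (δ ²) (δ ³) j ≈ signs j
      powers 0F = refl
      powers 1F = refl
      powers 2F = δ²≈1
      powers 3F = trans (*-congʳ δ²≈1) (*-identityˡ δ)

    ·M≈a³·diag4 : ∀ (y : Vec4) j → (y · M) j ≈ a ³ * (y · diag4 δ) j
    ·M≈a³·diag4 y j = trans (·Mabcd-cong refl b≈0 c≈0 d≈δa y j) (·Mabcd-diagonal a δ y j)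

    ·M≈a³signs* : ∀ (y : Vec4) j → (y · M) j ≈ a ³ * (signs j * y j)
    ·M≈a³signs* y j = trans (·M≈a³·diag4 y j) (*-congˡ (·diag4≈signs* y j))

    a³≉0 : ¬ a ³ ≈ 0#
    a³≉0 = *-preserves-≉0 (*-preserves-≉0 a≉0 a≉0) a≉0

    sameProjectivity : SameProjectivity M (diag4 δ)
    sameProjectivity x _ = ∼-scale (a ³) a³≉0 (·M≈a³·diag4 x)

    δ≈1⇒fixes-all : δ ≈ 1# → ∀ x → NonZeroVec x → (x · M) ∼ x
    δ≈1⇒fixes-all δ≈1 x _ = ∼-scale (a ³) a³≉0 λ j →
      trans (·M≈a³signs* x j) (*-congˡ (trans (*-congʳ (signs≈1 j)) (*-identityˡ (x j))))
      where
      signs≈1 : ∀ j → signs j ≈ 1#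
      signs≈1 0F = refl
      signs≈1 1F = δ≈1
      signs≈1 2F = refl
      signs≈1 3F = δ≈1

    involution : ∀ x → NonZeroVec x → ((x · M) · M) ∼ x
    involution x _ = ∼-scale (a ³ * a ³) (*-preserves-≉0 a³≉0 a³≉0) λ j → begin
      ((x · M) · M) j                              ≈⟨ ·M≈a³signs* (x · M) j ⟩
      a ³ * (signs j * (x · M) j)                  ≈⟨ *-congˡ (*-congˡ (·M≈a³signs* x j)) ⟩
      a ³ * (signs j * (a ³ * (signs j * x j)))    ≈⟨ rearrange (a ³) (signs j) (x j) ⟩
      a ³ * a ³ * (signs j * signs j * x j)        ≈⟨ *-congˡ (*-congʳ (signs²≈1 j)) ⟩
      a ³ * a ³ * (1# * x j)                       ≈⟨ *-congˡ (*-identityˡ (x j)) ⟩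
      a ³ * a ³ * x j                              ∎
      where
      rearrange : ∀ s u v → s * (u * (s * (u * v))) ≈ s * s * (u * u * v)
      rearrange = solve 3 (λ s u v → s :* (u :* (s :* (u :* v))) := s :* s :* (u :* u :* v)) refl

    line-image : ∀ μ γ → (vec γ μ γ 1# · M) ∼ vec (δ * γ) μ (δ * γ) 1#
    line-image μ γ = ∼-scale (a ³ * δ) (*-preserves-≉0 a³≉0 δ≉0) λ j → begin
      (v · M) j                ≈⟨ ·M≈a³signs* v j ⟩
      a ³ * (signs j * v j)    ≈⟨ *-congˡ (signs*v≈δ*u j) ⟩
      a ³ * (δ * u j)          ≈⟨ *-assoc (a ³) δ (u j) ⟨
      a ³ * δ * u j            ∎
      where
      v u : Vec4
      v = vec γ μ γ 1#
      u = vec (δ * γ) μ (δ * γ) 1#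
      δ≉0 : ¬ δ ≈ 0#
      δ≉0 δ≈0 = IsFieldOn.0≉1 isField (trans (sym (trans (*-congʳ δ≈0) (zeroˡ δ))) δ²≈1)
      δδγ≈γ : δ * (δ * γ) ≈ 1# * γ
      δδγ≈γ = trans (sym (*-assoc δ δ γ)) (*-congʳ δ²≈1)
      signs*v≈δ*u : ∀ j → signs j * v j ≈ δ * u j
      signs*v≈δ*u 0F = sym δδγ≈γ
      signs*v≈δ*u 1F = refl
      signs*v≈δ*u 2F = sym δδγ≈γ
      signs*v≈δ*u 3F = refl

lemma6p1 : ∀ {q} (F : FiniteField q) → 9 ≤ q → 3 ∣ q →
  let open FiniteField F
      open PG3 F
  in ∀ a b c d → ¬ (a * d - b * c ≈ 0#) →
     (vec 1# 0# 1# 0# · Mabcd a b c d) ∼ vec 1# 0# 1# 0# →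
     ∃ λ δ → (δ ≈ 1# ⊎ δ ≈ - 1#)
       × SameProjectivity (Mabcd a b c d) (diag4 δ)
       × (δ ≈ 1# → ∀ x → NonZeroVec x → (x · Mabcd a b c d) ∼ x)
       × (δ ≈ - 1# → ∀ x → NonZeroVec x → ((x · Mabcd a b c d) · Mabcd a b c d) ∼ x)
       × (∀ μ γ → (vec γ μ γ 1# · Mabcd a b c d) ∼ vec (δ * γ) μ (δ * γ) 1#)
lemma6p1 F _ 3∣q a b c d det≉0 fixes-P₁₀₁₀ =
  δ , δ≈±1 , sameProjectivity , δ≈1⇒fixes-all , (λ _ → involution) , line-image
  where
  open CharacteristicThree F (FieldProperties.characteristic-three F 3∣q)
  form : DiagonalForm a b c d
  form = fixes-P₁₀₁₀⇒diagonalForm det≉0 fixes-P₁₀₁₀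
  open DiagonalForm form using (δ; δ≈±1)
  open DiagonalFormProperties form
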